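{- Let $A=[A_1,A_2,\ldots,A_n]$ be an $n\times n\times n$ alternating sign hypermatrix (ASHM) with horizontal planes $A_1,\dots,A_n$, and for $k=1,\dots,n$ let $A^{(k)}=A_1+A_2+\cdots+A_k$. Then each $A^{(k)}$ is a $(0,1)$-matrix with exactly $k$ ones in every row and every column. In particular, $A^{(k+1)}$ has exactly $n$ more $1$'s than $A^{(k)}$ for $k=1,\dots,n-1$.
   Context: An $n\times n$ alternating sign matrix (ASM) is a $(0,\pm1)$-matrix in which, in every row and every column, the nonzero entries alternate in sign, beginning and ending with $+1$. For an $n\times n\times n$ $(0,\pm1)$-hypermatrix $A=[a_{ijk}]$, its horizontal planes are the $n\times n$ matrices $A_k=[a_{ijk}]_{i,j=1}^n$ ($1\le k\le n$), and we write $A=[A_1,\dots,A_n]$. The lines of $A$ are the vectors obtained by fixing two of the three indices and letting the third vary from $1$ to $n$ (row lines, column lines, vertical lines). $A$ is an alternating sign hypermatrix (ASHM) if in each of its $3n^2$ lines the nonzero entries alternate in sign beginning and ending with $+1$; equivalently every plane obtained by fixing one index is an ASM. -}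

module Defs where

open import Data.Nat using (ℕ; zero; suc; _<_)
open import Data.Integer using (ℤ; +_; -[1+_]; _+_; 0ℤ; 1ℤ)
open import Data.Fin using (Fin; toℕ)
open import Data.List using (List; []; _∷_)
open import Data.Product using (_×_)
open import Data.Sum using (_⊎_)
open import Relation.Binary.PropositionalEquality using (_≡_)

-- NeedPlus l: l has entries in {0,±1} whose
-- nonzero entries read +1,-1,+1,...,+1 (at least one +1).  AfterPlus l: the
-- remaining nonzero entries are empty or read -1,+1,...,+1.
mutual
  data NeedPlus : List ℤ → Set where
    np-zero : ∀ {l} → NeedPlus l → NeedPlus (0ℤ ∷ l)
    np-plus : ∀ {l} → AfterPlus l → NeedPlus (1ℤ ∷ l)

  data AfterPlus : List ℤ → Set where
    ap-nil   : AfterPlus []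
    ap-zero  : ∀ {l} → AfterPlus l → AfterPlus (0ℤ ∷ l)
    ap-minus : ∀ {l} → NeedPlus l → AfterPlus (-[1+ 0 ] ∷ l)

AltSignLine : List ℤ → Set
AltSignLine = NeedPlus

line : ∀ {n} → (Fin n → ℤ) → List ℤ
line {zero}  f = []
line {suc n} f = f Fin.zero ∷ line {n} (λ i → f (Fin.suc i))
  where import Data.Fin as Fin

-- n×n×n hypermatrix A i j k ; horizontal plane A_k = [a_ijk]_{i,j}
Hyper : ℕ → Set
Hyper n = Fin n → Fin n → Fin n → ℤ

IsASHM : ∀ {n} → Hyper n → Set
IsASHM {n} A =
  (∀ (j k : Fin n) → AltSignLine (line (λ i → A i j k))) ×
  (∀ (i k : Fin n) → AltSignLine (line (λ j → A i j k))) ×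
  (∀ (i j : Fin n) → AltSignLine (line (λ k → A i j k)))

sumFin : ∀ {n} → (Fin n → ℤ) → ℤ
sumFin {zero}  f = 0ℤ
sumFin {suc n} f = f Fin.zero + sumFin {n} (λ i → f (Fin.suc i))
  where import Data.Fin as Fin

-- sum of the first m terms f 0 + ... + f (m-1) (terms with index ≥ n ignored)
sumFirst : ∀ {n} → ℕ → (Fin n → ℤ) → ℤ
sumFirst {zero}  m       f = 0ℤ
sumFirst {suc n} zero    f = 0ℤ
sumFirst {suc n} (suc m) f = f Fin.zero + sumFirst {n} m (λ i → f (Fin.suc i))
  where import Data.Fin as Fin

partialSum : ∀ {n} → Hyper n → ℕ → Fin n → Fin n → ℤ
partialSum A m i j = sumFirst m (λ k → A i j k)

Is01 : ℤ → Set
Is01 x = (x ≡ 0ℤ) ⊎ (x ≡ 1ℤ)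

-- total number of 1's of a (0,1)-matrix = sum of its entries
totalSum : ∀ {n} → (Fin n → Fin n → ℤ) → ℤ
totalSum M = sumFin (λ i → sumFin (λ j → M i j))

module Submission where

-- Every line of an ASHM is an alternating sign line, and such a
-- line has two properties, both proved by induction on the defining grammar
-- NeedPlus/AfterPlus:
--   (a) each of its prefix sums is 0 or 1 (the partial sums of +1,-1,+1,...
--       oscillate between 0 and 1), and
--   (b) its total sum is 1.
-- Applying (a) to the vertical line (i,j) shows that the (i,j) entry of
-- A^(k) = A_1 + ... + A_k is 0 or 1.  For the row/column sums we interchange
-- the two finite sums: the i-th row sum of A^(k) is the sum over the first k
-- planes of the i-th row sum of A_l, and each of those is 1 by (b); hence it
-- is k.  Summing the n row sums gives totalSum A^(k) = n·k, from which the
-- difference n between consecutive totals is arithmetic.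

open import Defs
open import Data.Nat using (ℕ; zero; suc; _≤_; _<_; _*_; z≤n; s≤s)
import Data.Nat as ℕ using (_+_)
open import Data.Nat.Properties using (*-suc; +-comm; <⇒≤)
open import Data.Integer using (ℤ; +_; -[1+_]; _+_; 0ℤ; 1ℤ)
open import Data.Integer.Properties using (+-identityˡ; +-commutativeSemigroup; pos-+)
open import Data.Fin using (Fin)
import Data.Fin as F using (zero; suc)
open import Data.List using (List; []; _∷_)
open import Data.Product using (_×_; _,_)
open import Data.Sum using (_⊎_; inj₁; inj₂)
open import Relation.Binary.PropositionalEquality
  using (_≡_; refl; cong; cong₂; sym; subst; module ≡-Reasoning)
open import Algebra.Properties.CommutativeSemigroup +-commutativeSemigroup
  using (interchange)

prefixSum : ℕ → List ℤ → ℤ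
prefixSum zero    l       = 0ℤ
prefixSum (suc m) []      = 0ℤ
prefixSum (suc m) (x ∷ l) = x + prefixSum m l

listSum : List ℤ → ℤ
listSum []      = 0ℤ
listSum (x ∷ l) = x + listSum l

-- A (0,-1)-value: the possible prefix sums of a line that has just seen a +1.
Is0-1 : ℤ → Set
Is0-1 x = (x ≡ 0ℤ) ⊎ (x ≡ -[1+ 0 ])

mutual
  needPlus-prefix01 : ∀ {l} → NeedPlus l → ∀ m → Is01 (prefixSum m l)
  needPlus-prefix01 p             zero    = inj₁ refl
  needPlus-prefix01 (np-zero {l} p) (suc m)
    rewrite +-identityˡ (prefixSum m l) = needPlus-prefix01 p m
  needPlus-prefix01 (np-plus p)   (suc m) with afterPlus-prefix0-1 p m
  ... | inj₁ s≡0  rewrite s≡0  = inj₂ refl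
  ... | inj₂ s≡-1 rewrite s≡-1 = inj₁ refl

  afterPlus-prefix0-1 : ∀ {l} → AfterPlus l → ∀ m → Is0-1 (prefixSum m l)
  afterPlus-prefix0-1 p               zero    = inj₁ refl
  afterPlus-prefix0-1 ap-nil          (suc m) = inj₁ refl
  afterPlus-prefix0-1 (ap-zero {l} p) (suc m)
    rewrite +-identityˡ (prefixSum m l) = afterPlus-prefix0-1 p m
  afterPlus-prefix0-1 (ap-minus p)    (suc m) with needPlus-prefix01 p m
  ... | inj₁ s≡0 rewrite s≡0 = inj₂ refl
  ... | inj₂ s≡1 rewrite s≡1 = inj₁ refl

mutual
  needPlus-sum : ∀ {l} → NeedPlus l → listSum l ≡ 1ℤ
  needPlus-sum (np-zero {l} p) rewrite +-identityˡ (listSum l) = needPlus-sum p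
  needPlus-sum (np-plus p)     rewrite afterPlus-sum p         = refl

  afterPlus-sum : ∀ {l} → AfterPlus l → listSum l ≡ 0ℤ
  afterPlus-sum ap-nil          = refl
  afterPlus-sum (ap-zero {l} p) rewrite +-identityˡ (listSum l) = afterPlus-sum p
  afterPlus-sum (ap-minus p)    rewrite needPlus-sum p         = refl

sumFirst-line : ∀ {n} m (f : Fin n → ℤ) → sumFirst m f ≡ prefixSum m (line f)
sumFirst-line {zero}  zero    f = refl
sumFirst-line {zero}  (suc m) f = refl
sumFirst-line {suc n} zero    f = refl
sumFirst-line {suc n} (suc m) f =
  cong (_+_ (f F.zero)) (sumFirst-line m (λ i → f (F.suc i)))

sumFin-line : ∀ {n} (f : Fin n → ℤ) → sumFin f ≡ listSum (line f)
sumFin-line {zero}  f = refl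
sumFin-line {suc n} f = cong (_+_ (f F.zero)) (sumFin-line (λ i → f (F.suc i)))

altSign-sumFirst01 : ∀ {n} (f : Fin n → ℤ) → AltSignLine (line f) →
  ∀ m → Is01 (sumFirst m f)
altSign-sumFirst01 f alt m =
  subst Is01 (sym (sumFirst-line m f)) (needPlus-prefix01 alt m)

altSign-sum : ∀ {n} (f : Fin n → ℤ) → AltSignLine (line f) → sumFin f ≡ 1ℤ
altSign-sum f alt = begin
  sumFin f          ≡⟨ sumFin-line f ⟩
  listSum (line f)  ≡⟨ needPlus-sum alt ⟩
  1ℤ                ∎
  where open ≡-Reasoning

sumFin-cong : ∀ {n} {f g : Fin n → ℤ} → (∀ x → f x ≡ g x) → sumFin f ≡ sumFin g
sumFin-cong {zero}  f≗g = refl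
sumFin-cong {suc n} f≗g = cong₂ _+_ (f≗g F.zero) (sumFin-cong (λ x → f≗g (F.suc x)))

sumFirst-cong : ∀ {n} m {f g : Fin n → ℤ} → (∀ x → f x ≡ g x) →
  sumFirst m f ≡ sumFirst m g
sumFirst-cong {zero}  m       f≗g = refl
sumFirst-cong {suc n} zero    f≗g = refl
sumFirst-cong {suc n} (suc m) f≗g =
  cong₂ _+_ (f≗g F.zero) (sumFirst-cong m (λ x → f≗g (F.suc x)))

sumFin-zero : ∀ {n} → sumFin {n} (λ _ → 0ℤ) ≡ 0ℤ
sumFin-zero {zero}  = refl
sumFin-zero {suc n} = begin
  0ℤ + sumFin {n} (λ _ → 0ℤ)  ≡⟨ +-identityˡ _ ⟩
  sumFin {n} (λ _ → 0ℤ)       ≡⟨ sumFin-zero {n} ⟩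
  0ℤ                          ∎
  where open ≡-Reasoning

sumFin-+ : ∀ {n} (f g : Fin n → ℤ) → sumFin (λ j → f j + g j) ≡ sumFin f + sumFin g
sumFin-+ {zero}  f g = refl
sumFin-+ {suc n} f g = begin
  (f₀ + g₀) + sumFin (λ j → f′ j + g′ j)  ≡⟨ cong (_+_ (f₀ + g₀)) (sumFin-+ f′ g′) ⟩
  (f₀ + g₀) + (sumFin f′ + sumFin g′)     ≡⟨ interchange f₀ g₀ _ _ ⟩
  (f₀ + sumFin f′) + (g₀ + sumFin g′)     ∎
  where
  open ≡-Reasoning
  f₀ = f F.zero
  g₀ = g F.zero
  f′ = λ i → f (F.suc i)
  g′ = λ i → g (F.suc i)

sumFin-sumFirst-swap : ∀ {p q} m (g : Fin p → Fin q → ℤ) →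
  sumFin (λ j → sumFirst m (g j)) ≡ sumFirst m (λ l → sumFin (λ j → g j l))
sumFin-sumFirst-swap {p} {zero}  m       g = sumFin-zero {p}
sumFin-sumFirst-swap {p} {suc q} zero    g = sumFin-zero {p}
sumFin-sumFirst-swap {p} {suc q} (suc m) g = begin
  sumFin (λ j → g j F.zero + sumFirst m (g′ j))
    ≡⟨ sumFin-+ (λ j → g j F.zero) (λ j → sumFirst m (g′ j)) ⟩
  sumFin (λ j → g j F.zero) + sumFin (λ j → sumFirst m (g′ j))
    ≡⟨ cong (_+_ (sumFin (λ j → g j F.zero))) (sumFin-sumFirst-swap m g′) ⟩
  sumFin (λ j → g j F.zero) + sumFirst m (λ l → sumFin (λ j → g′ j l))
    ∎
  where
  open ≡-Reasoning
  g′ : Fin p → Fin q → ℤ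
  g′ j l = g j (F.suc l)

sumFirst-ones : ∀ {n} m → m ≤ n → sumFirst {n} m (λ _ → 1ℤ) ≡ + m
sumFirst-ones {zero}  zero    z≤n       = refl
sumFirst-ones {suc n} zero    _         = refl
sumFirst-ones {suc n} (suc m) (s≤s m≤n) = cong (_+_ 1ℤ) (sumFirst-ones m m≤n)

sumFin-const : ∀ {n} a → sumFin {n} (λ _ → + a) ≡ + (n * a)
sumFin-const {zero}  a = refl
sumFin-const {suc n} a = cong (_+_ (+ a)) (sumFin-const {n} a)

-- This
-- is the row (resp. column) sum of A^(m) when g j l = A i j l (resp. A j i l).
sumFin-sumFirst-unitSlices : ∀ {p n} m → m ≤ n → (g : Fin p → Fin n → ℤ) →
  (∀ l → sumFin (λ j → g j l) ≡ 1ℤ) → sumFin (λ j → sumFirst m (g j)) ≡ + m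
sumFin-sumFirst-unitSlices {n = n} m m≤n g unit = begin
  sumFin (λ j → sumFirst m (g j))        ≡⟨ sumFin-sumFirst-swap m g ⟩
  sumFirst m (λ l → sumFin (λ j → g j l)) ≡⟨ sumFirst-cong m unit ⟩
  sumFirst {n} m (λ _ → 1ℤ)              ≡⟨ sumFirst-ones m m≤n ⟩
  + m                                    ∎
  where open ≡-Reasoning

lemma2p1 : (n : ℕ) (A : Hyper n) → IsASHM A →
    ((k : ℕ) → 1 ≤ k → k ≤ n →
    (∀ i j → Is01 (partialSum A k i j)) ×
    (∀ i → sumFin (λ j → partialSum A k i j) ≡ + k) ×
    (∀ j → sumFin (λ i → partialSum A k i j) ≡ + k)) ×
    ((k : ℕ) → 1 ≤ k → k < n →
    totalSum (partialSum A (suc k)) ≡ totalSum (partialSum A k) + + n)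
lemma2p1 n A (cols , rows , verts) = planeSums , totalIncrement
  where
  rowSum : ∀ k → k ≤ n → ∀ i → sumFin (λ j → partialSum A k i j) ≡ + k
  rowSum k k≤n i = sumFin-sumFirst-unitSlices k k≤n (A i)
    (λ l → altSign-sum (λ j → A i j l) (rows i l))

  colSum : ∀ k → k ≤ n → ∀ j → sumFin (λ i → partialSum A k i j) ≡ + k
  colSum k k≤n j = sumFin-sumFirst-unitSlices k k≤n (λ i → A i j)
    (λ l → altSign-sum (λ i → A i j l) (cols j l))

  planeSums : (k : ℕ) → 1 ≤ k → k ≤ n →
    (∀ i j → Is01 (partialSum A k i j)) ×
    (∀ i → sumFin (λ j → partialSum A k i j) ≡ + k) ×
    (∀ j → sumFin (λ i → partialSum A k i j) ≡ + k)
  planeSums k _ k≤n =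
    (λ i j → altSign-sumFirst01 (A i j) (verts i j) k) , rowSum k k≤n , colSum k k≤n

  total : ∀ k → k ≤ n → totalSum (partialSum A k) ≡ + (n * k)
  total k k≤n = begin
    totalSum (partialSum A k)  ≡⟨ sumFin-cong (rowSum k k≤n) ⟩
    sumFin {n} (λ _ → + k)     ≡⟨ sumFin-const {n} k ⟩
    + (n * k)                  ∎
    where open ≡-Reasoning

  totalIncrement : (k : ℕ) → 1 ≤ k → k < n →
    totalSum (partialSum A (suc k)) ≡ totalSum (partialSum A k) + + n
  totalIncrement k _ k<n = begin
    totalSum (partialSum A (suc k))  ≡⟨ total (suc k) k<n ⟩
    + (n * suc k)                    ≡⟨ cong +_ (*-suc n k) ⟩
    + (n ℕ.+ n * k)                  ≡⟨ cong +_ (+-comm n (n * k)) ⟩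
    + (n * k ℕ.+ n)                  ≡⟨ pos-+ (n * k) n ⟩
    + (n * k) + + n                  ≡⟨ cong (_+ + n) (sym (total k (<⇒≤ k<n))) ⟩
    totalSum (partialSum A k) + + n  ∎
    where open ≡-Reasoning
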